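{- Let $\bar c\in\mathbb{N}^m$ and $\bar d\in\mathbb{N}^n$ be vectors with no zero entry. For all $\bar M\in\mathbb{N}^m$ and $\bar N\in\mathbb{N}^n$ with $\bar M\cdot\bar 1+\bar N\cdot\bar 1\ge 2(\bar c\cdot\bar 1)(\bar d\cdot\bar 1)+3$, there exists a $(\bar c,\bar d)$-biregular graph of size $(\bar M,\bar N)$ if and only if $\bar M\cdot\bar c=\bar N\cdot\bar d$.
   Context: $\bar 1$ denotes the all-ones vector of appropriate length and $\cdot$ is the usual dot product. For $\bar c=(c_1,\dots,c_m)$ and $\bar d=(d_1,\dots,d_n)$, a $(\bar c,\bar d)$-biregular graph is a simple bipartite graph with vertex classes $U,V$ together with partitions $U=U_1\cup\dots\cup U_m$, $V=V_1\cup\dots\cup V_n$ (parts may be empty) such that every vertex in $U_j$ has degree exactly $c_j$ and every vertex in $V_j$ has degree exactly $d_j$; it has size $(\bar M,\bar N)$ if $\bar M=(|U_1|,\dots,|U_m|)$ and $\bar N=(|V_1|,\dots,|V_n|)$. -}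

module Defs where

open import Data.Nat using (ℕ; zero; suc; _+_; _*_)
open import Data.Bool using (Bool; true; false)
open import Data.Fin using (Fin)
open import Data.Product using (Σ; _×_; _,_)

Σ[<_] : (n : ℕ) → (Fin n → ℕ) → ℕ
Σ[< zero ] f = 0
Σ[< suc n ] f = f Fin.zero + Σ[< n ] (λ i → f (Fin.suc i))

-- dot product and sum of entries (the "· 1̄")
_·_ : {m : ℕ} → (Fin m → ℕ) → (Fin m → ℕ) → ℕ
_·_ {m} x y = Σ[< m ] (λ i → x i * y i)

sum1 : {m : ℕ} → (Fin m → ℕ) → ℕ
sum1 {m} x = Σ[< m ] x

NoZero : {m : ℕ} → (Fin m → ℕ) → Set
NoZero x = ∀ i → x i ≢0
  where
  open import Relation.Binary.PropositionalEquality using (_≢_)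
  _≢0 : ℕ → Set
  k ≢0 = k ≢ 0

indicator : Bool → ℕ
indicator true = 1
indicator false = 0

-- Vertex classes: U = disjoint union of parts U_j with |U_j| = M j,
-- V = disjoint union of parts V_k with |V_k| = N k.
UVert : {m : ℕ} → (Fin m → ℕ) → Set
UVert {m} M = Σ (Fin m) (λ j → Fin (M j))

VVert : {n : ℕ} → (Fin n → ℕ) → Set
VVert {n} N = Σ (Fin n) (λ k → Fin (N k))

-- A simple bipartite graph between U and V is an adjacency relation U → V → Bool.
Adj : {m n : ℕ} → (Fin m → ℕ) → (Fin n → ℕ) → Set
Adj M N = UVert M → VVert N → Bool

degU : {m n : ℕ} {M : Fin m → ℕ} {N : Fin n → ℕ} → Adj M N → UVert M → ℕ
degU {n = n} {N = N} E u = Σ[< n ] (λ k → Σ[< N k ] (λ i → indicator (E u (k , i))))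

degV : {m n : ℕ} {M : Fin m → ℕ} {N : Fin n → ℕ} → Adj M N → VVert N → ℕ
degV {m = m} {M = M} E v = Σ[< m ] (λ j → Σ[< M j ] (λ i → indicator (E (j , i) v)))

open import Relation.Binary.PropositionalEquality using (_≡_)

record Biregular {m n : ℕ} (c : Fin m → ℕ) (d : Fin n → ℕ)
                 (M : Fin m → ℕ) (N : Fin n → ℕ) : Set where
  field
    adj  : Adj M N
    degU-ok : ∀ j (i : Fin (M j)) → degU adj (j , i) ≡ c j
    degV-ok : ∀ k (i : Fin (N k)) → degV adj (k , i) ≡ d k

module Submission where

-- Necessity is double counting of edges. For sufficiency, list the E = M·c = N·d half-edges of
-- each side consecutively, vertex by vertex, and match position p on the U side with position
-- σ p on the V side. Any matching yields the prescribed degrees, and the graph is simple as soon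
-- as no two half-edges at one vertex u reach the same vertex v. For σ, write positions row by
-- row into a grid with W > max c columns and read it column by column: half-edges at u lie
-- fewer than W − 1 apart, so σ sends them at least H = ⌊E / W⌋ apart, whereas the half-edges at
-- any v fill a window of length at most max d ≤ H. The size hypothesis provides a W with
-- W · max d ≤ E, after exchanging the two sides when U has a single part.

open import Defs
open import Data.Nat
open import Data.Nat.Properties
open import Data.Nat.DivMod
  using (_/_; _%_; m≡m%n+[m/n]*n; m%n<n; [m+kn]%n≡m%n; m<n⇒m%n≡m; +-distrib-/-∣ʳ; m<n⇒m/n≡0; m*n/n≡m; /-monoˡ-≤)
open import Data.Nat.Divisibility using (divides-refl)
open import Data.Nat.Tactic.RingSolver using (solve-∀)
open import Algebra.Properties.CommutativeSemigroup +-commutativeSemigroup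
  using (interchange; x∙yz≈y∙xz; xy∙z≈xz∙y; xy∙z≈y∙xz)
open import Data.Fin using (Fin; zero; suc; toℕ; fromℕ<; cast; punchOut; _↑ˡ_; _↑ʳ_; splitAt; combine; remQuot)
open import Data.Fin.Properties
  using (any?; pigeonhole; punchOut-injective; toℕ-injective; toℕ-fromℕ<; toℕ<n; toℕ-cast; cast-involutive;
         toℕ-↑ˡ; toℕ-↑ʳ; splitAt-↑ˡ; splitAt-↑ʳ; splitAt⁻¹-↑ˡ; splitAt⁻¹-↑ʳ;
         remQuot-combine; combine-remQuot; toℕ-combine)
  renaming (_≟_ to _≟ᶠ_; suc-injective to fsuc-injective)
open import Data.Product using (Σ; _×_; _,_; proj₁; proj₂; ∃)
open import Data.Product.Properties using (≡-dec)
open import Data.Sum using (_⊎_; inj₁; inj₂; [_,_]′)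
open import Data.Empty using (⊥-elim)
open import Function using (_∘_; id; case_of_; _⇔_; Equivalence; mk⇔; _↔_; Inverse; mk↔ₛ′)
open import Function.Definitions using (Injective)
open import Function.Construct.Composition using (_↔-∘_)
open import Function.Construct.Symmetry using (↔-sym)
open import Level using (0ℓ)
open import Relation.Binary.Definitions using (tri<; tri≈; tri>)
open import Relation.Binary.PropositionalEquality
  using (_≡_; _≢_; refl; sym; trans; cong; cong₂; subst; subst₂; module ≡-Reasoning)
open import Relation.Nullary using (¬_; Dec; yes; no)
open import Relation.Nullary.Decidable using (⌊_⌋)
open import Relation.Unary using (Pred; Decidable)

Σ-cong : ∀ n {f g : Fin n → ℕ} → (∀ i → f i ≡ g i) → Σ[< n ] f ≡ Σ[< n ] g
Σ-cong zero    f≗g = refl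
Σ-cong (suc n) f≗g = cong₂ _+_ (f≗g zero) (Σ-cong n (f≗g ∘ suc))

Σ-distrib-+ : ∀ n (f g : Fin n → ℕ) → Σ[< n ] (λ i → f i + g i) ≡ Σ[< n ] f + Σ[< n ] g
Σ-distrib-+ zero    f g = refl
Σ-distrib-+ (suc n) f g =
  trans (cong (f zero + g zero +_) (Σ-distrib-+ n (f ∘ suc) (g ∘ suc)))
        (interchange (f zero) (g zero) _ _)

Σ-zero : ∀ n {f : Fin n → ℕ} → (∀ i → f i ≡ 0) → Σ[< n ] f ≡ 0
Σ-zero zero    f≗0 = refl
Σ-zero (suc n) f≗0 = cong₂ _+_ (f≗0 zero) (Σ-zero n (f≗0 ∘ suc))

Σ-single : ∀ n (f : Fin n → ℕ) i₀ → (∀ i → i ≢ i₀ → f i ≡ 0) → Σ[< n ] f ≡ f i₀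
Σ-single (suc n) f zero     vanish =
  trans (cong (f zero +_) (Σ-zero n (λ i → vanish (suc i) λ ()))) (+-identityʳ _)
Σ-single (suc n) f (suc i₀) vanish =
  cong₂ _+_ (vanish zero λ ()) (Σ-single n (f ∘ suc) i₀ λ i i≢i₀ → vanish (suc i) (i≢i₀ ∘ fsuc-injective))

Σ-comm : ∀ a b (f : Fin a → Fin b → ℕ) →
         Σ[< a ] (λ x → Σ[< b ] (f x)) ≡ Σ[< b ] (λ y → Σ[< a ] (λ x → f x y))
Σ-comm zero    b f = sym (Σ-zero b (λ _ → refl))
Σ-comm (suc a) b f = trans (cong (Σ[< b ] (f zero) +_) (Σ-comm a b (f ∘ suc)))
                           (sym (Σ-distrib-+ b (f zero) _))

Σ-const : ∀ n k → Σ[< n ] (λ _ → k) ≡ n * k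
Σ-const zero    k = refl
Σ-const (suc n) k = cong (k +_) (Σ-const n k)

term≤Σ : ∀ n (f : Fin n → ℕ) i → f i ≤ Σ[< n ] f
term≤Σ (suc n) f zero    = m≤m+n _ _
term≤Σ (suc n) f (suc i) = ≤-trans (term≤Σ n (f ∘ suc) i) (m≤n+m _ _)

Σ-mono-≤ : ∀ n {f g : Fin n → ℕ} → (∀ i → f i ≤ g i) → Σ[< n ] f ≤ Σ[< n ] g
Σ-mono-≤ zero    f≤g = z≤n
Σ-mono-≤ (suc n) f≤g = +-mono-≤ (f≤g zero) (Σ-mono-≤ n (f≤g ∘ suc))

-- VVert N is definitionally Vertex N, so everything stated for Vertex serves both sides.
Vertex : {m : ℕ} → (Fin m → ℕ) → Set
Vertex = UVert

_≟ᵛ_ : ∀ {m} {L : Fin m → ℕ} (x y : Vertex L) → Dec (x ≡ y)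
_≟ᵛ_ = ≡-dec _≟ᶠ_ _≟ᶠ_

ΣΣ : {m : ℕ} (L : Fin m → ℕ) → (Vertex L → ℕ) → ℕ
ΣΣ {m} L f = Σ[< m ] (λ j → Σ[< L j ] (λ i → f (j , i)))

ΣΣ-cong : ∀ {m} (L : Fin m → ℕ) {f g : Vertex L → ℕ} → (∀ x → f x ≡ g x) → ΣΣ L f ≡ ΣΣ L g
ΣΣ-cong {m} L f≗g = Σ-cong m (λ j → Σ-cong (L j) (λ i → f≗g (j , i)))

ΣΣ-distrib-+ : ∀ {m} (L : Fin m → ℕ) (f g : Vertex L → ℕ) →
               ΣΣ L (λ x → f x + g x) ≡ ΣΣ L f + ΣΣ L g
ΣΣ-distrib-+ {m} L f g = trans (Σ-cong m (λ j → Σ-distrib-+ (L j) _ _)) (Σ-distrib-+ m _ _)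

ΣΣ-comm : ∀ {m n} (L : Fin m → ℕ) (L′ : Fin n → ℕ) (f : Vertex L → Vertex L′ → ℕ) →
          ΣΣ L (λ x → ΣΣ L′ (f x)) ≡ ΣΣ L′ (λ y → ΣΣ L (λ x → f x y))
ΣΣ-comm {m} {n} L L′ f = begin
  Σ[< m ] (λ j → Σ[< L j ] (λ i → Σ[< n ] (λ k → Σ[< L′ k ] (λ l → f (j , i) (k , l)))))
    ≡⟨ Σ-cong m (λ j → Σ-comm (L j) n _) ⟩
  Σ[< m ] (λ j → Σ[< n ] (λ k → Σ[< L j ] (λ i → Σ[< L′ k ] (λ l → f (j , i) (k , l)))))
    ≡⟨ Σ-cong m (λ j → Σ-cong n (λ k → Σ-comm (L j) (L′ k) _)) ⟩
  Σ[< m ] (λ j → Σ[< n ] (λ k → Σ[< L′ k ] (λ l → Σ[< L j ] (λ i → f (j , i) (k , l)))))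
    ≡⟨ Σ-comm m n _ ⟩
  Σ[< n ] (λ k → Σ[< m ] (λ j → Σ[< L′ k ] (λ l → Σ[< L j ] (λ i → f (j , i) (k , l)))))
    ≡⟨ Σ-cong n (λ k → Σ-comm m (L′ k) _) ⟩
  Σ[< n ] (λ k → Σ[< L′ k ] (λ l → Σ[< m ] (λ j → Σ[< L j ] (λ i → f (j , i) (k , l))))) ∎
  where open ≡-Reasoning

ΣΣ-∘proj₁ : ∀ {m} (L f : Fin m → ℕ) → ΣΣ L (f ∘ proj₁) ≡ L · f
ΣΣ-∘proj₁ {m} L f = Σ-cong m (λ j → Σ-const (L j) (f j))

indicator-yes : ∀ {P : Set} → P → (p : Dec P) → indicator ⌊ p ⌋ ≡ 1
indicator-yes _ (yes _) = refl
indicator-yes x (no ¬x) = ⊥-elim (¬x x)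

indicator-no : ∀ {P : Set} → ¬ P → (p : Dec P) → indicator ⌊ p ⌋ ≡ 0
indicator-no ¬x (yes x) = ⊥-elim (¬x x)
indicator-no _  (no _)  = refl

indicator-⊎ : ∀ {P A B : Set} → P ⇔ (A ⊎ B) → ¬ (A × B) →
              (p : Dec P) (a : Dec A) (b : Dec B) → indicator ⌊ p ⌋ ≡ indicator ⌊ a ⌋ + indicator ⌊ b ⌋
indicator-⊎ _     disjoint _      (yes a) (yes b) = ⊥-elim (disjoint (a , b))
indicator-⊎ P⇔A⊎B _        p      (yes a) (no _)  = indicator-yes (Equivalence.from P⇔A⊎B (inj₁ a)) p
indicator-⊎ P⇔A⊎B _        p      (no _)  (yes b) = indicator-yes (Equivalence.from P⇔A⊎B (inj₂ b)) p
indicator-⊎ P⇔A⊎B _        p      (no ¬a) (no ¬b) =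
  indicator-no (λ x → [ ¬a , ¬b ]′ (Equivalence.to P⇔A⊎B x)) p

ΣΣ-zero : ∀ {m} (L : Fin m → ℕ) {f : Vertex L → ℕ} → (∀ x → f x ≡ 0) → ΣΣ L f ≡ 0
ΣΣ-zero {m} L f≗0 = Σ-zero m (λ j → Σ-zero (L j) (λ i → f≗0 (j , i)))

ΣΣ-indicator-≡ : ∀ {m} (L : Fin m → ℕ) (x₀ : Vertex L) → ΣΣ L (λ x → indicator ⌊ x ≟ᵛ x₀ ⌋) ≡ 1
ΣΣ-indicator-≡ {m} L (j₀ , i₀) = begin
  ΣΣ L (λ x → indicator ⌊ x ≟ᵛ (j₀ , i₀) ⌋)
    ≡⟨ Σ-single m _ j₀ (λ j j≢j₀ → Σ-zero (L j) (λ i → indicator-no (j≢j₀ ∘ cong proj₁) _)) ⟩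
  Σ[< L j₀ ] (λ i → indicator ⌊ (j₀ , i) ≟ᵛ (j₀ , i₀) ⌋)
    ≡⟨ Σ-single (L j₀) _ i₀ (λ i i≢i₀ → indicator-no (λ { refl → i≢i₀ refl }) _) ⟩
  indicator ⌊ (j₀ , i₀) ≟ᵛ (j₀ , i₀) ⌋
    ≡⟨ indicator-yes refl _ ⟩
  1 ∎
  where open ≡-Reasoning

count-image : ∀ {m a} (L : Fin m → ℕ) (f : Fin a → Vertex L) → Injective _≡_ _≡_ f →
              {P : Pred (Vertex L) 0ℓ} (P? : Decidable P) → (∀ x → P x ⇔ (∃ λ i → f i ≡ x)) →
              ΣΣ L (λ x → indicator ⌊ P? x ⌋) ≡ a
count-image {a = zero} L f _ P? P⇔image =
  ΣΣ-zero L (λ x → indicator-no (λ p → case Equivalence.to (P⇔image x) p of λ ()) (P? x))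
count-image {a = suc a} L f f-inj {P} P? P⇔image = begin
  ΣΣ L (λ x → indicator ⌊ P? x ⌋)
    ≡⟨ ΣΣ-cong L (λ x → indicator-⊎ (split x) disjoint (P? x) (x ≟ᵛ f zero) (image-of-suc? x)) ⟩
  ΣΣ L (λ x → indicator ⌊ x ≟ᵛ f zero ⌋ + indicator ⌊ image-of-suc? x ⌋)
    ≡⟨ ΣΣ-distrib-+ L _ _ ⟩
  ΣΣ L (λ x → indicator ⌊ x ≟ᵛ f zero ⌋) + ΣΣ L (λ x → indicator ⌊ image-of-suc? x ⌋)
    ≡⟨ cong₂ _+_ (ΣΣ-indicator-≡ L (f zero))
                 (count-image L (f ∘ suc) (fsuc-injective ∘ f-inj) image-of-suc? (λ _ → mk⇔ id id)) ⟩
  suc a ∎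
  where
  open ≡-Reasoning
  image-of-suc? : ∀ x → Dec (∃ λ i → f (suc i) ≡ x)
  image-of-suc? x = any? (λ i → f (suc i) ≟ᵛ x)
  split : ∀ x → P x ⇔ (x ≡ f zero ⊎ ∃ λ i → f (suc i) ≡ x)
  split x = mk⇔ (λ p → case Equivalence.to (P⇔image x) p of λ where
                         (zero , e)  → inj₁ (sym e)
                         (suc i , e) → inj₂ (i , e))
                (λ where (inj₁ e)       → Equivalence.from (P⇔image x) (zero , sym e)
                         (inj₂ (i , e)) → Equivalence.from (P⇔image x) (suc i , e))
  disjoint : ∀ {x} → ¬ (x ≡ f zero × ∃ λ i → f (suc i) ≡ x)
  disjoint (refl , i , e) = case f-inj e of λ ()

double-counting : ∀ {m n} {c : Fin m → ℕ} {d : Fin n → ℕ} {M : Fin m → ℕ} {N : Fin n → ℕ} →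
                  Biregular c d M N → M · c ≡ N · d
double-counting {c = c} {d} {M} {N} G = begin
  M · c                  ≡⟨ ΣΣ-∘proj₁ M c ⟨
  ΣΣ M (c ∘ proj₁)       ≡⟨ ΣΣ-cong M (λ (j , i) → degU-ok j i) ⟨
  ΣΣ M (degU adj)        ≡⟨ ΣΣ-comm M N _ ⟩
  ΣΣ N (degV adj)        ≡⟨ ΣΣ-cong N (λ (k , l) → degV-ok k l) ⟩
  ΣΣ N (d ∘ proj₁)       ≡⟨ ΣΣ-∘proj₁ N d ⟩
  N · d                  ∎
  where
  open ≡-Reasoning
  open Biregular G

HalfEdge : ∀ {m} (L deg : Fin m → ℕ) → Set
HalfEdge L deg = Σ (Vertex L) (λ u → Fin (deg (proj₁ u)))

halfEdge-at : ∀ {m} {L deg : Fin m → ℕ} (w : HalfEdge L deg) {u} → proj₁ w ≡ u → ∃ λ s → (u , s) ≡ w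
halfEdge-at (_ , s) refl = s , refl

module _ {m n} {c : Fin m → ℕ} {d : Fin n → ℕ} {M : Fin m → ℕ} {N : Fin n → ℕ}
         (π : HalfEdge M c ↔ HalfEdge N d)
         (simple : ∀ u {s s′} → proj₁ (Inverse.to π (u , s)) ≡ proj₁ (Inverse.to π (u , s′)) → s ≡ s′)
         where

  open Inverse π

  matchingAdj : Adj M N
  matchingAdj u v = ⌊ any? (λ s → proj₁ (to (u , s)) ≟ᵛ v) ⌋

  private
    partner : ∀ (v : Vertex N) → Fin (d (proj₁ v)) → Vertex M
    partner v t = proj₁ (from (v , t))

    partner-injective : ∀ v → Injective _≡_ _≡_ (partner v)
    partner-injective v {t} {t′} same
      with s , e ← halfEdge-at (from (v , t)) refl
         | s′ , e′ ← halfEdge-at (from (v , t′)) (sym same)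
      with refl ← simple (partner v t) (trans (cong proj₁ (inverseˡ e)) (cong proj₁ (sym (inverseˡ e′))))
      with refl ← trans (sym (inverseˡ e)) (inverseˡ e′)
      = refl

    adjacent⇔partner : ∀ u v → (∃ λ s → proj₁ (to (u , s)) ≡ v) ⇔ (∃ λ t → partner v t ≡ u)
    adjacent⇔partner u v = mk⇔
      (λ (s , e) → let t , e′ = halfEdge-at (to (u , s)) e in t , cong proj₁ (inverseʳ e′))
      (λ (t , e) → let s , e′ = halfEdge-at (from (v , t)) e in s , cong proj₁ (inverseˡ e′))

  biregular-from-matching : Biregular c d M N
  biregular-from-matching = record
    { adj     = matchingAdj
    ; degU-ok = λ j i → count-image N (λ s → proj₁ (to ((j , i) , s))) (simple (j , i)) _ (λ _ → mk⇔ id id)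
    ; degV-ok = λ k l → count-image M (partner (k , l)) (partner-injective (k , l)) _ (λ u → adjacent⇔partner u (k , l))
    }

offset : ∀ {m} → (Fin m → ℕ) → Fin m → ℕ
offset L zero    = 0
offset L (suc j) = L zero + offset (L ∘ suc) j

flat : ∀ {m} (L : Fin m → ℕ) → Vertex L → Fin (Σ[< m ] L)
flat {suc m} L (zero  , x) = x ↑ˡ Σ[< m ] (L ∘ suc)
flat {suc m} L (suc j , x) = L zero ↑ʳ flat (L ∘ suc) (j , x)

unflat : ∀ {m} (L : Fin m → ℕ) → Fin (Σ[< m ] L) → Vertex L
unflat {suc m} L y with splitAt (L zero) y
... | inj₁ x = zero , x
... | inj₂ z with unflat (L ∘ suc) z
...   | j , x = suc j , x

unflat-flat : ∀ {m} (L : Fin m → ℕ) x → unflat L (flat L x) ≡ x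
unflat-flat {suc m} L (zero , x) rewrite splitAt-↑ˡ (L zero) x (Σ[< m ] (L ∘ suc)) = refl
unflat-flat {suc m} L (suc j , x)
  rewrite splitAt-↑ʳ (L zero) (Σ[< m ] (L ∘ suc)) (flat (L ∘ suc) (j , x))
        | unflat-flat (L ∘ suc) (j , x) = refl

flat-unflat : ∀ {m} (L : Fin m → ℕ) y → flat L (unflat L y) ≡ y
flat-unflat {suc m} L y with splitAt (L zero) y in split≡
... | inj₁ x = splitAt⁻¹-↑ˡ split≡
... | inj₂ z with unflat (L ∘ suc) z in unflat≡
...   | j , x = trans (cong ((L zero ↑ʳ_) ∘ flat (L ∘ suc)) (sym unflat≡))
                      (trans (cong (L zero ↑ʳ_) (flat-unflat (L ∘ suc) z)) (splitAt⁻¹-↑ʳ split≡))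

flatten : ∀ {m} (L : Fin m → ℕ) → Vertex L ↔ Fin (Σ[< m ] L)
flatten L = mk↔ₛ′ (flat L) (unflat L) (flat-unflat L) (unflat-flat L)

toℕ-flatten : ∀ {m} (L : Fin m → ℕ) j (x : Fin (L j)) →
              toℕ (Inverse.to (flatten L) (j , x)) ≡ offset L j + toℕ x
toℕ-flatten {suc m} L zero    x = toℕ-↑ˡ x _
toℕ-flatten {suc m} L (suc j) x = begin
  toℕ (L zero ↑ʳ flat (L ∘ suc) (j , x))       ≡⟨ toℕ-↑ʳ (L zero) _ ⟩
  L zero + toℕ (flat (L ∘ suc) (j , x))        ≡⟨ cong (L zero +_) (toℕ-flatten (L ∘ suc) j x) ⟩
  L zero + (offset (L ∘ suc) j + toℕ x)        ≡⟨ +-assoc (L zero) _ _ ⟨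
  L zero + offset (L ∘ suc) j + toℕ x          ∎
  where open ≡-Reasoning

regroup : ∀ {m} (L deg : Fin m → ℕ) → HalfEdge L deg ↔ Vertex (λ j → L j * deg j)
regroup L deg = mk↔ₛ′
  (λ ((j , i) , s) → j , combine i s)
  (λ (j , y) → let (i , s) = remQuot (deg j) y in (j , i) , s)
  (λ (j , y) → cong (j ,_) (combine-remQuot {L j} (deg j) y))
  (λ ((j , i) , s) → cong (λ (i′ , s′) → (j , i′) , s′) (remQuot-combine i s))

enumerate : ∀ {m} (L deg : Fin m → ℕ) → HalfEdge L deg ↔ Fin (L · deg)
enumerate L deg = flatten (λ j → L j * deg j) ↔-∘ regroup L deg

start : ∀ {m} (L deg : Fin m → ℕ) → Vertex L → ℕ
start L deg (j , i) = offset (λ j → L j * deg j) j + deg j * toℕ i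

position : ∀ {m} (L deg : Fin m → ℕ) → HalfEdge L deg → ℕ
position L deg = toℕ ∘ Inverse.to (enumerate L deg)

position-≡ : ∀ {m} (L deg : Fin m → ℕ) (u : Vertex L) (s : Fin (deg (proj₁ u))) →
             position L deg (u , s) ≡ start L deg u + toℕ s
position-≡ L deg (j , i) s = begin
  toℕ (Inverse.to (flatten (λ j → L j * deg j)) (j , combine i s))
    ≡⟨ toℕ-flatten (λ j → L j * deg j) j (combine i s) ⟩
  offset (λ j → L j * deg j) j + toℕ (combine i s)
    ≡⟨ cong (offset (λ j → L j * deg j) j +_) (toℕ-combine i s) ⟩
  offset (λ j → L j * deg j) j + (deg j * toℕ i + toℕ s)
    ≡⟨ +-assoc (offset (λ j → L j * deg j) j) _ _ ⟨
  start L deg (j , i) + toℕ s ∎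
  where open ≡-Reasoning

cast-↔ : ∀ {a b} → a ≡ b → Fin a ↔ Fin b
cast-↔ a≡b = mk↔ₛ′ (cast a≡b) (cast (sym a≡b)) (cast-involutive a≡b (sym a≡b)) (cast-involutive (sym a≡b) a≡b)

-- A value missed by f would make f an injection of Fin (suc n) into Fin n.
injective⇒surjective : ∀ {n} (f : Fin n → Fin n) → Injective _≡_ _≡_ f → ∀ y → ∃ λ x → f x ≡ y
injective⇒surjective {suc n} f f-inj y with any? (λ x → f x ≟ᶠ y)
... | yes hit = hit
... | no miss
  with i , j , i<j , same ← pigeonhole (n<1+n n) (λ x → punchOut (λ y≡fx → miss (x , sym y≡fx)))
  = ⊥-elim (<-irrefl (cong toℕ (f-inj (punchOut-injective (λ e → miss (i , sym e)) (λ e → miss (j , sym e)) same))) i<j)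

injective⇒↔ : ∀ {n} (f : Fin n → Fin n) → Injective _≡_ _≡_ f → Fin n ↔ Fin n
injective⇒↔ f f-inj = mk↔ₛ′ f (proj₁ ∘ surjective) (proj₂ ∘ surjective) (λ x → f-inj (proj₂ (surjective (f x))))
  where
  surjective : ∀ y → ∃ λ x → f x ≡ y
  surjective = injective⇒surjective f f-inj

Apart : ℕ → ℕ → ℕ → Set
Apart h x y = x + h ≤ y ⊎ y + h ≤ x

¬Apart-window : ∀ {h} b {x y} → x < h → y < h → ¬ Apart h (b + x) (b + y)
¬Apart-window {h} b {x} {y} x<h y<h (inj₁ b+x+h≤b+y) =
  <⇒≱ y<h (≤-trans (m≤n+m h x) (+-cancelˡ-≤ b _ _ (subst (_≤ b + y) (+-assoc b x h) b+x+h≤b+y)))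
¬Apart-window {h} b {x} {y} x<h y<h (inj₂ b+y+h≤b+x) =
  <⇒≱ x<h (≤-trans (m≤n+m h y) (+-cancelˡ-≤ b _ _ (subst (_≤ b + x) (+-assoc b y h) b+y+h≤b+x)))

-- Position p sits in column p % W and row p / W of a grid whose first r columns have H + 1
-- cells and the others H; σ numbers the cells column by column, columnStart a being the number
-- of cells left of column a.
module Transpose (E W : ℕ) .{{_ : NonZero W}} where

  H r : ℕ
  H = E / W
  r = E % W

  E-grid : E ≡ r + H * W
  E-grid = m≡m%n+[m/n]*n E W

  columnStart : ℕ → ℕ
  columnStart a = a * H + a ⊓ r

  σ : ℕ → ℕ
  σ p = columnStart (p % W) + p / W

  columnStart-suc : ∀ a → columnStart a + H ≤ columnStart (suc a)
  columnStart-suc a = begin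
    a * H + a ⊓ r + H     ≡⟨ shuffle (a * H) (a ⊓ r) H ⟩
    H + a * H + a ⊓ r     ≤⟨ +-monoʳ-≤ (H + a * H) (⊓-monoˡ-≤ r (n≤1+n a)) ⟩
    H + a * H + suc a ⊓ r ∎
    where
    open ≤-Reasoning
    shuffle : ∀ x y z → x + y + z ≡ z + x + y
    shuffle = solve-∀

  columnStart-suc-< : ∀ {a} → a < r → columnStart (suc a) ≡ suc (columnStart a + H)
  columnStart-suc-< {a} a<r = begin
    H + a * H + suc a ⊓ r   ≡⟨ cong (H + a * H +_) (m≤n⇒m⊓n≡m a<r) ⟩
    H + a * H + suc a       ≡⟨ shuffle (a * H) a H ⟩
    suc (a * H + a + H)     ≡⟨ cong (λ x → suc (a * H + x + H)) (m≤n⇒m⊓n≡m (<⇒≤ a<r)) ⟨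
    suc (a * H + a ⊓ r + H) ∎
    where
    open ≡-Reasoning
    shuffle : ∀ x y z → z + x + suc y ≡ suc (x + y + z)
    shuffle = solve-∀

  columnStart-mono : ∀ {a b} → a ≤ b → columnStart a ≤ columnStart b
  columnStart-mono a≤b = +-mono-≤ (*-monoˡ-≤ H a≤b) (⊓-monoˡ-≤ r a≤b)

  columnStart-gap : ∀ {a b} → a < b → columnStart a + H ≤ columnStart b
  columnStart-gap {a} a<b = ≤-trans (columnStart-suc a) (columnStart-mono a<b)

  columnStart-W : columnStart W ≡ E
  columnStart-W = begin
    W * H + W ⊓ r  ≡⟨ cong (W * H +_) (m≥n⇒m⊓n≡n (<⇒≤ (m%n<n E W))) ⟩
    W * H + r      ≡⟨ +-comm (W * H) r ⟩
    r + W * H      ≡⟨ cong (r +_) (*-comm W H) ⟩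
    r + H * W      ≡⟨ E-grid ⟨
    E              ∎
    where open ≡-Reasoning

  σ-grid : ∀ {col} row → col < W → σ (col + row * W) ≡ columnStart col + row
  σ-grid {col} row col<W = cong₂ _+_ (cong columnStart col≡) row≡
    where
    col≡ : (col + row * W) % W ≡ col
    col≡ = trans ([m+kn]%n≡m%n col row W) (m<n⇒m%n≡m col<W)
    row≡ : (col + row * W) / W ≡ row
    row≡ = trans (+-distrib-/-∣ʳ col (divides-refl row)) (cong₂ _+_ (m<n⇒m/n≡0 col<W) (m*n/n≡m row W))

  grid-cell : ∀ {col row} → col < W → col + row * W < r + H * W → columnStart col + row < columnStart (suc col)
  grid-cell {col} {row} col<W p<E with <-cmp row H
  ... | tri< row<H _ _ = <-≤-trans (+-monoʳ-< (columnStart col) row<H) (columnStart-suc col)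
  ... | tri≈ _ refl _  = subst (columnStart col + H <_) (sym (columnStart-suc-< col<r)) ≤-refl
    where
    col<r : col < r
    col<r = +-cancelʳ-< (H * W) col r p<E
  ... | tri> _ _ H<row = ⊥-elim (<-asym p<E (begin-strict
    r + H * W       <⟨ +-monoˡ-< (H * W) (m%n<n E W) ⟩
    suc H * W       ≤⟨ *-monoˡ-≤ W H<row ⟩
    row * W         ≤⟨ m≤n+m (row * W) col ⟩
    col + row * W   ∎))
    where open ≤-Reasoning

  σ-in-column : ∀ {p} → p < E → σ p < columnStart (suc (p % W))
  σ-in-column {p} p<E = grid-cell (m%n<n p W) (subst₂ _<_ (m≡m%n+[m/n]*n p W) E-grid p<E)

  σ-< : ∀ {p} → p < E → σ p < E
  σ-< {p} p<E = begin-strict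
    σ p                        <⟨ σ-in-column p<E ⟩
    columnStart (suc (p % W))  ≤⟨ columnStart-mono (m%n<n p W) ⟩
    columnStart W              ≡⟨ columnStart-W ⟩
    E                          ∎
    where open ≤-Reasoning

  σ-monotone-column : ∀ {p p′} → p < E → p % W < p′ % W → σ p < σ p′
  σ-monotone-column {p} {p′} p<E col<col′ = begin-strict
    σ p                        <⟨ σ-in-column p<E ⟩
    columnStart (suc (p % W))  ≤⟨ columnStart-mono col<col′ ⟩
    columnStart (p′ % W)       ≤⟨ m≤m+n _ _ ⟩
    σ p′                       ∎
    where open ≤-Reasoning

  σ-injective : ∀ {p p′} → p < E → p′ < E → σ p ≡ σ p′ → p ≡ p′
  σ-injective {p} {p′} p<E p′<E σp≡σp′ with <-cmp (p % W) (p′ % W)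
  ... | tri< col<col′ _ _ = ⊥-elim (<-irrefl σp≡σp′ (σ-monotone-column p<E col<col′))
  ... | tri> _ _ col′<col = ⊥-elim (<-irrefl (sym σp≡σp′) (σ-monotone-column p′<E col′<col))
  ... | tri≈ _ col≡col′ _ = begin
    p                   ≡⟨ m≡m%n+[m/n]*n p W ⟩
    p % W + p / W * W   ≡⟨ cong₂ (λ col row → col + row * W) col≡col′ row≡row′ ⟩
    p′ % W + p′ / W * W ≡⟨ m≡m%n+[m/n]*n p′ W ⟨
    p′                  ∎
    where
    open ≡-Reasoning
    row≡row′ : p / W ≡ p′ / W
    row≡row′ = +-cancelˡ-≡ (columnStart (p % W)) _ _ (trans σp≡σp′ (cong (λ col → columnStart col + p′ / W) (sym col≡col′)))

  -- If p + δ wraps to the next row it lands at least two columns further left, which outweighs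
  -- the row it gains.
  σ-spread-grid : 1 ≤ H → ∀ {col} row δ → col < W → 1 ≤ δ → δ + 2 ≤ W →
                  Apart H (σ (col + row * W)) (σ (col + row * W + δ))
  σ-spread-grid 1≤H {col} row δ col<W 1≤δ δ+2≤W
    rewrite σ-grid row col<W with col + δ <? W
  ... | yes col+δ<W = inj₁ (begin
    columnStart col + row + H        ≡⟨ xy∙z≈xz∙y (columnStart col) row H ⟩
    columnStart col + H + row        ≤⟨ +-monoˡ-≤ row (columnStart-gap (m<m+n col 1≤δ)) ⟩
    columnStart (col + δ) + row      ≡⟨ σ-grid row col+δ<W ⟨
    σ (col + δ + row * W)            ≡⟨ cong σ (xy∙z≈xz∙y col δ (row * W)) ⟩
    σ (col + row * W + δ)            ∎)
    where open ≤-Reasoning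
  ... | no col+δ≮W with col′ , W+col′≡col+δ ← m≤n⇒∃[o]m+o≡n (≮⇒≥ col+δ≮W) = inj₂ (begin
    σ (col + row * W + δ) + H           ≡⟨ cong (λ p → σ p + H) wrap ⟩
    σ (col′ + suc row * W) + H          ≡⟨ cong (_+ H) (σ-grid (suc row) col′<W) ⟩
    columnStart col′ + suc row + H      ≡⟨ shuffle (columnStart col′) row H ⟩
    columnStart col′ + H + 1 + row      ≤⟨ +-monoˡ-≤ row (+-monoʳ-≤ (columnStart col′ + H) 1≤H) ⟩
    columnStart col′ + H + H + row      ≤⟨ +-monoˡ-≤ row (+-monoˡ-≤ H (columnStart-suc col′)) ⟩
    columnStart (suc col′) + H + row    ≤⟨ +-monoˡ-≤ row (columnStart-gap col′+1<col) ⟩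
    columnStart col + row               ∎)
    where
    open ≤-Reasoning
    shuffle : ∀ x y z → x + suc y + z ≡ x + z + 1 + y
    shuffle = solve-∀
    col′+1<col : suc col′ < col
    col′+1<col = +-cancelˡ-≤ W _ _ (begin
      W + (2 + col′)   ≡⟨ x∙yz≈y∙xz W 2 col′ ⟩
      2 + (W + col′)   ≡⟨ cong (2 +_) W+col′≡col+δ ⟩
      2 + (col + δ)    ≡⟨ cong (2 +_) (+-comm col δ) ⟩
      2 + (δ + col)    ≡⟨ +-assoc 2 δ col ⟨
      2 + δ + col      ≤⟨ +-monoˡ-≤ col (subst (_≤ W) (+-comm δ 2) δ+2≤W) ⟩
      W + col          ∎)
    col′<W : col′ < W
    col′<W = <-trans (n<1+n col′) (<-trans col′+1<col col<W)
    wrap : col + row * W + δ ≡ col′ + suc row * W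
    wrap = begin-equality
      col + row * W + δ    ≡⟨ xy∙z≈xz∙y col (row * W) δ ⟩
      col + δ + row * W    ≡⟨ cong (_+ row * W) W+col′≡col+δ ⟨
      W + col′ + row * W   ≡⟨ xy∙z≈y∙xz W col′ (row * W) ⟩
      col′ + suc row * W   ∎

  σ-spread : 1 ≤ H → ∀ p δ → 1 ≤ δ → δ + 2 ≤ W → Apart H (σ p) (σ (p + δ))
  σ-spread 1≤H p δ 1≤δ δ+2≤W =
    subst (λ q → Apart H (σ q) (σ (q + δ))) (sym (m≡m%n+[m/n]*n p W))
          (σ-spread-grid 1≤H (p / W) δ (m%n<n p W) 1≤δ δ+2≤W)

  σᶠ : Fin E → Fin E
  σᶠ p = fromℕ< (σ-< (toℕ<n p))

  toℕ-σᶠ : ∀ p → toℕ (σᶠ p) ≡ σ (toℕ p)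
  toℕ-σᶠ p = toℕ-fromℕ< (σ-< (toℕ<n p))

  σ↔ : Fin E ↔ Fin E
  σ↔ = injective⇒↔ σᶠ λ {p} {p′} same → toℕ-injective
    (σ-injective (toℕ<n p) (toℕ<n p′) (trans (sym (toℕ-σᶠ p)) (trans (cong toℕ same) (toℕ-σᶠ p′))))

biregular-from-degree-bounds :
  ∀ {m n} {c : Fin m → ℕ} {d : Fin n → ℕ} {M : Fin m → ℕ} {N : Fin n → ℕ} {K D : ℕ} →
  (∀ j → c j ≤ K) → (∀ k → d k ≤ D) → 1 ≤ D → suc K * D ≤ M · c → M · c ≡ N · d →
  Biregular c d M N
biregular-from-degree-bounds {c = c} {d} {M} {N} {K} {D} c≤K d≤D 1≤D large balanced =
  biregular-from-matching π simple
  where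
  E W : ℕ
  E = M · c
  W = suc K
  open Transpose E W

  D≤H : D ≤ H
  D≤H = subst (_≤ H) (m*n/n≡m D W) (/-monoˡ-≤ W (subst (_≤ E) (*-comm W D) large))

  π : HalfEdge M c ↔ HalfEdge N d
  π = ↔-sym (enumerate N d) ↔-∘ (cast-↔ balanced ↔-∘ (σ↔ ↔-∘ enumerate M c))

  position-π : ∀ x → position N d (Inverse.to π x) ≡ σ (position M c x)
  position-π x = begin
    toℕ (Inverse.to (enumerate N d) (Inverse.from (enumerate N d) y))
      ≡⟨ cong toℕ (Inverse.strictlyInverseˡ (enumerate N d) y) ⟩
    toℕ (cast balanced (σᶠ (Inverse.to (enumerate M c) x)))
      ≡⟨ toℕ-cast balanced _ ⟩
    toℕ (σᶠ (Inverse.to (enumerate M c) x))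
      ≡⟨ toℕ-σᶠ (Inverse.to (enumerate M c) x) ⟩
    σ (position M c x) ∎
    where
    open ≡-Reasoning
    y = cast balanced (σᶠ (Inverse.to (enumerate M c) x))

  landing : ∀ x {v} → proj₁ (Inverse.to π x) ≡ v →
            ∃ λ (t : Fin (d (proj₁ v))) → σ (position M c x) ≡ start N d v + toℕ t
  landing x {v} at-v with t , v,t≡πx ← halfEdge-at (Inverse.to π x) at-v =
    t , trans (sym (position-π x)) (trans (cong (position N d) (sym v,t≡πx)) (position-≡ N d v t))

  no-repeat : ∀ u {s s′ : Fin (c (proj₁ u))} → toℕ s < toℕ s′ →
              ¬ proj₁ (Inverse.to π (u , s)) ≡ proj₁ (Inverse.to π (u , s′))
  no-repeat u {s} {s′} s<s′ same
    with t , σp≡ ← landing (u , s) refl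
       | t′ , σp′≡ ← landing (u , s′) (sym same) =
    ¬Apart-window (start N d v) (in-window t) (in-window t′)
      (subst₂ (Apart H) σp≡ σp′≡ (subst (Apart H (σ p) ∘ σ) p+δ≡p′ (σ-spread 1≤H p δ 1≤δ δ+2≤W)))
    where
    v = proj₁ (Inverse.to π (u , s))
    p = position M c (u , s)
    δ = toℕ s′ ∸ toℕ s
    1≤H : 1 ≤ H
    1≤H = ≤-trans 1≤D D≤H
    in-window : (t : Fin (d (proj₁ v))) → toℕ t < H
    in-window t = <-≤-trans (toℕ<n t) (≤-trans (d≤D _) D≤H)
    1≤δ : 1 ≤ δ
    1≤δ = m<n⇒0<n∸m s<s′
    δ+2≤W : δ + 2 ≤ W
    δ+2≤W = subst (_≤ W) (+-comm 2 δ) (s≤s (<-≤-trans (≤-<-trans (m∸n≤m (toℕ s′) (toℕ s)) (toℕ<n s′)) (c≤K _)))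
    p+δ≡p′ : p + δ ≡ position M c (u , s′)
    p+δ≡p′ = begin
      p + δ                              ≡⟨ cong (_+ δ) (position-≡ M c u s) ⟩
      start M c u + toℕ s + δ            ≡⟨ +-assoc (start M c u) (toℕ s) δ ⟩
      start M c u + (toℕ s + δ)          ≡⟨ cong (start M c u +_) (m+[n∸m]≡n (<⇒≤ s<s′)) ⟩
      start M c u + toℕ s′               ≡⟨ position-≡ M c u s′ ⟨
      position M c (u , s′)              ∎
      where open ≡-Reasoning

  simple : ∀ u {s s′} → proj₁ (Inverse.to π (u , s)) ≡ proj₁ (Inverse.to π (u , s′)) → s ≡ s′
  simple u {s} {s′} same with <-cmp (toℕ s) (toℕ s′)
  ... | tri< s<s′ _ _ = ⊥-elim (no-repeat u s<s′ same)
  ... | tri≈ _ s≡s′ _ = toℕ-injective s≡s′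
  ... | tri> _ _ s′<s = ⊥-elim (no-repeat u s′<s (sym same))

swap-sides : ∀ {m n} {c : Fin m → ℕ} {d : Fin n → ℕ} {M : Fin m → ℕ} {N : Fin n → ℕ} →
             Biregular d c N M → Biregular c d M N
swap-sides G = record { adj = λ u v → adj v u ; degU-ok = degV-ok ; degV-ok = degU-ok }
  where open Biregular G

sum≤dot : ∀ {m} (M c : Fin m → ℕ) → NoZero c → sum1 M ≤ M · c
sum≤dot {m} M c c≢0 = Σ-mono-≤ m (λ j → m≤m*n (M j) (c j) {{≢-nonZero (c≢0 j)}})

term<Σ : ∀ {m} (f : Fin (suc (suc m)) → ℕ) → (∀ i → 1 ≤ f i) → ∀ i → f i < Σ[< suc (suc m) ] f
term<Σ f f≥1 zero    = m<m+n (f zero) (≤-trans (f≥1 (suc zero)) (m≤m+n _ _))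
term<Σ f f≥1 (suc i) = ≤-<-trans (term≤Σ _ (f ∘ suc) i) (m<n+m _ (f≥1 zero))

2*m+3≤n+n⇒2+m≤n : ∀ m n → 2 * m + 3 ≤ n + n → 2 + m ≤ n
2*m+3≤n+n⇒2+m≤n m n bound = *-cancelˡ-< 2 (suc m) n (subst₂ _≤_ (lhs m) (rhs n) bound)
  where
  lhs : ∀ m → 2 * m + 3 ≡ suc (2 * suc m)
  lhs = solve-∀
  rhs : ∀ n → n + n ≡ 2 * n
  rhs = solve-∀

2+m*n≤o*m⇒[1+n]*m≤o*m : ∀ {m n o} → 2 + m * n ≤ o * m → suc n * m ≤ o * m
2+m*n≤o*m⇒[1+n]*m≤o*m {m} {n} {o} bound = *-monoˡ-≤ m (*-cancelʳ-< m n o (begin-strict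
  n * m   ≡⟨ *-comm n m ⟩
  m * n   <⟨ ≤-trans (n≤1+n _) bound ⟩
  o * m   ∎))
  where open ≤-Reasoning

biregular-of-large-size : ∀ {m n} {c : Fin m → ℕ} {d : Fin n → ℕ} {M : Fin m → ℕ} {N : Fin n → ℕ} →
                          NoZero c → NoZero d → M · c ≡ N · d → 2 + sum1 c * sum1 d ≤ M · c →
                          Biregular c d M N
biregular-of-large-size {zero} _ _ _ ()
-- With one part in U no K < sum1 c bounds c, so the sides are exchanged; M₀ c₀ > c₀ D forces M₀ > D.
biregular-of-large-size {suc zero} {c = c} {d} {M} {N} c≢0 _ balanced large =
  swap-sides (biregular-from-degree-bounds (term≤Σ _ d) (term≤Σ 1 c) 1≤C large′ (sym balanced))
  where
  C D : ℕ
  C = sum1 c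
  D = sum1 d
  single : M · c ≡ M zero * C
  single = trans (+-identityʳ _) (cong (M zero *_) (sym (+-identityʳ _)))
  1≤C : 1 ≤ C
  1≤C = ≤-trans (n≢0⇒n>0 (c≢0 zero)) (term≤Σ 1 c zero)
  large′ : suc D * C ≤ N · d
  large′ = subst (suc D * C ≤_) (trans (sym single) balanced)
                 (2+m*n≤o*m⇒[1+n]*m≤o*m {o = M zero} (subst (2 + C * D ≤_) single large))
biregular-of-large-size {suc (suc m)} {zero} _ _ balanced large = ⊥-elim (<⇒≢ (≤-trans (s≤s z≤n) large) (sym balanced))
biregular-of-large-size {suc (suc m)} {suc n} {c = c} {d} {M} c≢0 d≢0 balanced large =
  biregular-from-degree-bounds (<⇒≤pred ∘ c<C) (term≤Σ _ d) 1≤D large′ balanced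
  where
  C D : ℕ
  C = sum1 c
  D = sum1 d
  c<C : ∀ j → c j < C
  c<C = term<Σ c (n≢0⇒n>0 ∘ c≢0)
  instance
    C≢0 : NonZero C
    C≢0 = >-nonZero (≤-<-trans z≤n (c<C zero))
  1≤D : 1 ≤ D
  1≤D = ≤-trans (n≢0⇒n>0 (d≢0 zero)) (term≤Σ _ d zero)
  large′ : suc (pred C) * D ≤ M · c
  large′ = subst (λ k → k * D ≤ M · c) (sym (suc-pred C)) (≤-trans (m≤n+m _ 2) large)

lemma1 : {m n : ℕ} (c : Fin m → ℕ) (d : Fin n → ℕ) → NoZero c → NoZero d →
         (M : Fin m → ℕ) (N : Fin n → ℕ) →
         sum1 M + sum1 N ≥ 2 * (sum1 c * sum1 d) + 3 →
         (Biregular c d M N ⇔ (M · c ≡ N · d))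
lemma1 c d c≢0 d≢0 M N size = mk⇔ double-counting λ balanced →
  biregular-of-large-size c≢0 d≢0 balanced (2*m+3≤n+n⇒2+m≤n _ _ (begin
    2 * (sum1 c * sum1 d) + 3   ≤⟨ size ⟩
    sum1 M + sum1 N             ≤⟨ +-mono-≤ (sum≤dot M c c≢0) (sum≤dot N d d≢0) ⟩
    M · c + N · d               ≡⟨ cong (M · c +_) balanced ⟨
    M · c + M · c               ∎))
  where open ≤-Reasoning
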